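{- Taking paths indexed by $(\mathbb{N},\mathcal{C}_{succ})$: there exist a closure model $\mathcal{M}$ and points $x_1,x_2$ of $\mathcal{M}$ that are CoPa-bisimilar but not trace equivalent; and there exist a closure model $\mathcal{M}$ and points $x_1,x_2$ of $\mathcal{M}$ that are trace equivalent but not CoPa-bisimilar.
   Context: A closure space is $(X,\mathcal{C})$, $X$ non-empty, with $\mathcal{C}(\emptyset)=\emptyset$, $A\subseteq\mathcal{C}(A)$, $\mathcal{C}(A_1\cup A_2)=\mathcal{C}(A_1)\cup\mathcal{C}(A_2)$. A closure model is $(X,\mathcal{C},\mathcal{V})$ with $\mathcal{V}:AP\to\mathcal{P}(X)$ for a fixed set $AP$; $\mathcal{V}^{ -1}(x)=\{p:x\in\mathcal{V}(p)\}$. Paths: $\mathcal{C}_{succ}(N')=N'\cup\{n+1:n\in N'\}$; a path is $\pi:\mathbb{N}\to X$ with $\pi(\mathcal{C}_{succ}(N'))\subseteq\mathcal{C}(\pi(N'))$ for all $N'\subseteq\mathbb{N}$; bounded if some $\ell$ has $\pi(i)=\pi(\ell)$ for $i\ge\ell$, $\mathrm{len}(\pi)$ the least such $\ell$. $\mathrm{BPaths^F}(x)$: bounded paths with $\pi(0)=x$; $\mathrm{BPaths^T}(x)$: bounded paths with $\pi(\mathrm{len}(\pi))=x$. Trace: $\mathrm{Tr}(\pi)(i)=\mathcal{V}^{ -1}(\pi(i))$; $x_1,x_2$ are trace equivalent if $\{\mathrm{Tr}(\pi):\pi\in\mathrm{BPaths^F}(x_1)\}=\{\mathrm{Tr}(\pi):\pi\in\mathrm{BPaths^F}(x_2)\}$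 and likewise for $\mathrm{BPaths^T}$. CoPa-bisimulation: non-empty $B\subseteq X\times X$ such that whenever $(x_1,x_2)\in B$: (1) $\mathcal{V}^{ -1}(x_1)=\mathcal{V}^{ -1}(x_2)$; (2) for every $\pi_1\in\mathrm{BPaths^F}(x_1)$ with $(\pi_1(i),x_2)\in B$ for all $0\le i<\mathrm{len}(\pi_1)$, there is $\pi_2\in\mathrm{BPaths^F}(x_2)$ with $(x_1,\pi_2(i))\in B$ for all $0\le i<\mathrm{len}(\pi_2)$ and $(\pi_1(\mathrm{len}(\pi_1)),\pi_2(\mathrm{len}(\pi_2)))\in B$; (3) the symmetric condition starting from $\pi_2\in\mathrm{BPaths^F}(x_2)$; (4) for every $\pi_1\in\mathrm{BPaths^T}(x_1)$ with $(\pi_1(i),x_2)\in B$ for all $0<i\le\mathrm{len}(\pi_1)$, there is $\pi_2\in\mathrm{BPaths^T}(x_2)$ with $(x_1,\pi_2(i))\in B$ for all $0<i\le\mathrm{len}(\pi_2)$ and $(\pi_1(0),\pi_2(0))\in B$; (5) the symmetric condition starting from $\pi_2\in\mathrm{BPaths^T}(x_2)$. CoPa-bisimilar: contained in some CoPa-bisimulation. -}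

module Defs where

open import Data.Nat using (ℕ; suc; _≤_; _<_)
open import Data.Product using (Σ; ∃; _×_; _,_)
open import Data.Sum using (_⊎_)
open import Data.Empty using (⊥)
open import Relation.Nullary using (¬_)
open import Relation.Binary.PropositionalEquality using (_≡_)

Subset : Set → Set₁
Subset X = X → Set

∅ : {X : Set} → Subset X
∅ _ = ⊥

_∪_ : {X : Set} → Subset X → Subset X → Subset X
(A ∪ B) x = A x ⊎ B x

_⊆_ : {X : Set} → Subset X → Subset X → Set
A ⊆ B = ∀ x → A x → B x

_≐_ : {X : Set} → Subset X → Subset X → Set
A ≐ B = (A ⊆ B) × (B ⊆ A)

image : {A B : Set} → (A → B) → Subset A → Subset B
image f N y = ∃ λ a → N a × f a ≡ y

record ClosureSpace : Set₁ where
  field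
    Pt        : Set
    inhabited : Pt
    C         : Subset Pt → Subset Pt
    -- C is a function on sets: extensionally equal arguments give equal results
    C-ext     : ∀ {A B} → A ≐ B → C A ≐ C B
    C-∅       : C ∅ ≐ ∅
    C-incl    : ∀ A → A ⊆ C A
    C-∪       : ∀ A₁ A₂ → C (A₁ ∪ A₂) ≐ (C A₁ ∪ C A₂)

record ClosureModel (AP : Set) : Set₁ where
  field
    space : ClosureSpace
  open ClosureSpace space public
  field
    V : AP → Subset Pt

  V⁻¹ : Pt → Subset AP
  V⁻¹ x p = V p x

Csucc : Subset ℕ → Subset ℕ
Csucc N n = N n ⊎ (∃ λ m → N m × suc m ≡ n)

module _ {AP : Set} (M : ClosureModel AP) where
  open ClosureModel M

  IsPath : (ℕ → Pt) → Set₁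
  IsPath π = ∀ (N : Subset ℕ) → image π (Csucc N) ⊆ C (image π N)

  StableFrom : (ℕ → Pt) → ℕ → Set
  StableFrom π ℓ = ∀ i → ℓ ≤ i → π i ≡ π ℓ

  IsLen : (ℕ → Pt) → ℕ → Set
  IsLen π ℓ = StableFrom π ℓ × (∀ k → k < ℓ → ¬ StableFrom π k)

  record BPath : Set₁ where
    field
      path   : ℕ → Pt
      isPath : IsPath path
      len    : ℕ
      isLen  : IsLen path len

  open BPath public

  BPathsF : Pt → BPath → Set
  BPathsF x π = path π 0 ≡ x

  BPathsT : Pt → BPath → Set
  BPathsT x π = path π (len π) ≡ x

  SameTrace : BPath → BPath → Set
  SameTrace π π' = ∀ i → V⁻¹ (path π i) ≐ V⁻¹ (path π' i)

  SameTraceSets : (BPath → Set) → (BPath → Set) → Set₁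
  SameTraceSets P Q =
      (∀ π₁ → P π₁ → ∃ λ π₂ → Q π₂ × SameTrace π₁ π₂)
    × (∀ π₂ → Q π₂ → ∃ λ π₁ → P π₁ × SameTrace π₁ π₂)

  TraceEquivalent : Pt → Pt → Set₁
  TraceEquivalent x₁ x₂ =
    SameTraceSets (BPathsF x₁) (BPathsF x₂) × SameTraceSets (BPathsT x₁) (BPathsT x₂)

  record IsCoPaBisimulation (B : Pt → Pt → Set) : Set₁ where
    field
      nonEmpty : ∃ λ x → ∃ λ y → B x y
      cond1 : ∀ {x₁ x₂} → B x₁ x₂ → V⁻¹ x₁ ≐ V⁻¹ x₂
      cond2 : ∀ {x₁ x₂} → B x₁ x₂ → ∀ π₁ → BPathsF x₁ π₁ →
              (∀ i → i < len π₁ → B (path π₁ i) x₂) →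
              ∃ λ π₂ → BPathsF x₂ π₂ × (∀ i → i < len π₂ → B x₁ (path π₂ i))
                       × B (path π₁ (len π₁)) (path π₂ (len π₂))
      cond3 : ∀ {x₁ x₂} → B x₁ x₂ → ∀ π₂ → BPathsF x₂ π₂ →
              (∀ i → i < len π₂ → B x₁ (path π₂ i)) →
              ∃ λ π₁ → BPathsF x₁ π₁ × (∀ i → i < len π₁ → B (path π₁ i) x₂)
                       × B (path π₁ (len π₁)) (path π₂ (len π₂))
      cond4 : ∀ {x₁ x₂} → B x₁ x₂ → ∀ π₁ → BPathsT x₁ π₁ →
              (∀ i → 0 < i → i ≤ len π₁ → B (path π₁ i) x₂) →
              ∃ λ π₂ → BPathsT x₂ π₂ × (∀ i → 0 < i → i ≤ len π₂ → B x₁ (path π₂ i))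
                       × B (path π₁ 0) (path π₂ 0)
      cond5 : ∀ {x₁ x₂} → B x₁ x₂ → ∀ π₂ → BPathsT x₂ π₂ →
              (∀ i → 0 < i → i ≤ len π₂ → B x₁ (path π₂ i)) →
              ∃ λ π₁ → BPathsT x₁ π₁ × (∀ i → 0 < i → i ≤ len π₁ → B (path π₁ i) x₂)
                       × B (path π₁ 0) (path π₂ 0)

  CoPaBisimilar : Pt → Pt → Set₁
  CoPaBisimilar x₁ x₂ = ∃ λ (B : Pt → Pt → Set) → IsCoPaBisimulation B × B x₁ x₂

module Submission where

-- Both examples are finite graphs whose closure adds to a set the successors of its points,
-- with every atomic proposition true exactly at the red points.
-- In the first, a → r and b → c → r with only r red. The trace (∅, AP) is that of a path
-- from a but of no path from b, yet the identity together with (a, b) and (a, c) is a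
-- CoPa-bisimulation: the step a → r is matched by b → c → r, whose intermediate point c is
-- again related to a.
-- In the second, x₁ → r₁ → g₁, x₁ → r₂ and x₂ → r₃ → g₃ with the rᵢ red. Colour-preserving
-- graph homomorphisms in both directions (folding both branches at x₁ onto x₂ → r₃ → g₃, and
-- embedding that back as x₁ → r₁ → g₁) transfer all traces. But a CoPa-bisimulation relating
-- x₁ and x₂ must match x₁ → r₂ from x₂, which relates r₂ to r₃, the only red point reachable
-- from x₂; matching r₃ → g₃ from the dead end r₂ then relates the red r₂ to the non-red g₃.

open import Defs
open import Data.Bool using (Bool; true; false; T)
open import Data.Empty using (⊥)
open import Data.Fin using (Fin; zero; suc)
import Data.Fin as Fin
open import Data.Unit using (⊤; tt)
open import Data.Nat using (ℕ; zero; suc; _≤_; _<_; z≤n; s≤s)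
open import Data.Nat.Properties using (≤-refl; ≤-trans; m≤n⇒m≤1+n; m≤n⇒m<n∨m≡n)
open import Data.Product using (Σ; ∃; _×_; _,_; proj₁; proj₂)
import Data.Product as Product
open import Data.Sum using (inj₁; inj₂)
import Data.Sum as Sum
open import Function using (flip; id; _∘_)
open import Relation.Binary.Construct.Closure.Reflexive as Refl using (ReflClosure; refl; [_])
open import Relation.Binary.Definitions using (DecidableEquality)
open import Relation.Binary.PropositionalEquality using (_≡_; refl; sym; trans; cong; subst; subst₂)
open import Relation.Nullary using (¬_; yes; no)

module _ {AP : Set} (M : ClosureModel AP) where
  open ClosureModel M using (Pt; V⁻¹)

  TracesCovered : (BPath M → Set) → (BPath M → Set) → Set₁
  TracesCovered Π₁ Π₂ = ∀ π₁ → Π₁ π₁ → ∃ λ π₂ → Π₂ π₂ × SameTrace M π₁ π₂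

  sameTraceSets : ∀ {Π₁ Π₂} → TracesCovered Π₁ Π₂ → TracesCovered Π₂ Π₁ → SameTraceSets M Π₁ Π₂
  sameTraceSets covered₁₂ covered₂₁ = covered₁₂ , λ π₂ π₂∈Π₂ →
    let π₁ , π₁∈Π₁ , same = covered₂₁ π₂ π₂∈Π₂ in π₁ , π₁∈Π₁ , λ i → Product.swap (same i)

  MatchedFrom : (Pt → Pt → Set) → Pt → Pt → Pt → Set₁
  MatchedFrom B x₁ x₂ e = ∃ λ π₂ → BPathsF M x₂ π₂
    × (∀ i → i < len π₂ → B x₁ (path π₂ i)) × B e (path π₂ (len π₂))

  MatchedTo : (Pt → Pt → Set) → Pt → Pt → Pt → Set₁
  MatchedTo B x₁ x₂ s = ∃ λ π₂ → BPathsT M x₂ π₂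
    × (∀ i → 0 < i → i ≤ len π₂ → B x₁ (path π₂ i)) × B s (path π₂ 0)

  ForthFrom : (Pt → Pt → Set) → Set₁
  ForthFrom B = ∀ {x₁ x₂} → B x₁ x₂ → ∀ π₁ → BPathsF M x₁ π₁ →
    (∀ i → i < len π₁ → B (path π₁ i) x₂) → MatchedFrom B x₁ x₂ (path π₁ (len π₁))

  ForthTo : (Pt → Pt → Set) → Set₁
  ForthTo B = ∀ {x₁ x₂} → B x₁ x₂ → ∀ π₁ → BPathsT M x₁ π₁ →
    (∀ i → 0 < i → i ≤ len π₁ → B (path π₁ i) x₂) → MatchedTo B x₁ x₂ (path π₁ 0)

  -- Conditions (3) and (5) are conditions (2) and (4) for the converse relation.
  isCoPaBisimulation : ∀ {B} → (∃ λ x → ∃ λ y → B x y) →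
    (∀ {x₁ x₂} → B x₁ x₂ → V⁻¹ x₁ ≐ V⁻¹ x₂) →
    ForthFrom B → ForthFrom (flip B) → ForthTo B → ForthTo (flip B) →
    IsCoPaBisimulation M B
  isCoPaBisimulation nonEmpty sameLabels forthFrom backFrom forthTo backTo = record
    { nonEmpty = nonEmpty
    ; cond1 = sameLabels
    ; cond2 = forthFrom
    ; cond3 = backFrom
    ; cond4 = forthTo
    ; cond5 = backTo
    }

module GraphModel {AP P : Set} (_≟_ : DecidableEquality P) (p₀ : P)
                  (E : P → P → Set) (red : P → Bool) where

  closure : Subset P → Subset P
  closure A x = A x Sum.⊎ ∃ λ y → A y × E y x

  closure-mono : ∀ {A B} → A ⊆ B → closure A ⊆ closure B
  closure-mono A⊆B x = Sum.map (A⊆B x) (Product.map₂ (Product.map₁ (A⊆B _)))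

  closure-∅ : closure ∅ ≐ ∅
  closure-∅ = (λ { _ (inj₁ ()) ; _ (inj₂ (_ , () , _)) }) , (λ _ ())

  closure-∪ : ∀ A₁ A₂ → closure (A₁ ∪ A₂) ≐ (closure A₁ ∪ closure A₂)
  closure-∪ A₁ A₂ = split , merge
    where
    split : closure (A₁ ∪ A₂) ⊆ (closure A₁ ∪ closure A₂)
    split _ (inj₁ (inj₁ x∈A₁)) = inj₁ (inj₁ x∈A₁)
    split _ (inj₁ (inj₂ x∈A₂)) = inj₂ (inj₁ x∈A₂)
    split _ (inj₂ (y , inj₁ y∈A₁ , e)) = inj₁ (inj₂ (y , y∈A₁ , e))
    split _ (inj₂ (y , inj₂ y∈A₂ , e)) = inj₂ (inj₂ (y , y∈A₂ , e))
    merge : (closure A₁ ∪ closure A₂) ⊆ closure (A₁ ∪ A₂)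
    merge = λ x → Sum.[ closure-mono (λ _ → inj₁) x , closure-mono (λ _ → inj₂) x ]

  space : ClosureSpace
  space = record
    { Pt = P ; inhabited = p₀ ; C = closure
    ; C-ext = λ (A⊆B , B⊆A) → closure-mono A⊆B , closure-mono B⊆A
    ; C-∅ = closure-∅ ; C-incl = λ _ _ → inj₁ ; C-∪ = closure-∪ }

  model : ClosureModel AP
  model = record { space = space ; V = λ _ x → T (red x) }

  Step : P → P → Set
  Step = ReflClosure E

  Steps : (ℕ → P) → Set
  Steps π = ∀ n → Step (π n) (π (suc n))

  closure-step : ∀ {A x y} → A x → Step x y → closure A y
  closure-step x∈A refl = inj₁ x∈A
  closure-step x∈A [ e ] = inj₂ (_ , x∈A , e)

  steps⇒isPath : ∀ {π} → Steps π → IsPath model π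
  steps⇒isPath steps N y (n , inj₁ n∈N , πn≡y) = inj₁ (n , n∈N , πn≡y)
  steps⇒isPath steps N _ (_ , inj₂ (m , m∈N , refl) , refl) =
    closure-step (m , m∈N , refl) (steps m)

  isPath⇒steps : ∀ {π} → IsPath model π → Steps π
  isPath⇒steps isπ n with isπ (_≡ n) _ (suc n , inj₂ (n , refl , refl) , refl)
  ... | inj₁ (_ , refl , πn≡πsn) = Refl.reflexive πn≡πsn
  ... | inj₂ (_ , (_ , refl , refl) , e) = [ e ]

  step : (π : BPath model) → Steps (path π)
  step π = isPath⇒steps (isPath π)

  leastStable : ∀ π L → StableFrom model π L → ∃ λ ℓ → ℓ ≤ L × IsLen model π ℓ
  leastStable π zero stable = 0 , z≤n , stable , λ _ ()
  leastStable π (suc k) stable with π k ≟ π (suc k)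
  ... | yes πk≡πsk =
    let ℓ , ℓ≤k , isLen = leastStable π k stableFromK in ℓ , m≤n⇒m≤1+n ℓ≤k , isLen
    where
    stableFromK : StableFrom model π k
    stableFromK i k≤i with m≤n⇒m<n∨m≡n k≤i
    ... | inj₁ k<i = trans (stable i k<i) (sym πk≡πsk)
    ... | inj₂ refl = refl
  ... | no πk≢πsk = suc k , ≤-refl , stable , notStableBefore
    where
    notStableBefore : ∀ j → j < suc k → ¬ StableFrom model π j
    notStableBefore j (s≤s j≤k) stableFromJ =
      πk≢πsk (trans (stableFromJ k j≤k) (sym (stableFromJ (suc k) (m≤n⇒m≤1+n j≤k))))

  boundedPath : ∀ π → Steps π → ∀ L → StableFrom model π L → BPath model
  boundedPath π steps L stable = record
    { path = π ; isPath = steps⇒isPath steps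
    ; len = proj₁ (leastStable π L stable) ; isLen = proj₂ (proj₂ (leastStable π L stable)) }

  module _ π (steps : Steps π) L (stable : StableFrom model π L) where
    private
      π′ = boundedPath π steps L stable

    boundedPath-len≤ : len π′ ≤ L
    boundedPath-len≤ = proj₁ (proj₂ (leastStable π L stable))

    boundedPath-end : path π′ (len π′) ≡ π L
    boundedPath-end = sym (proj₁ (isLen π′) L boundedPath-len≤)

  twoPoint : P → P → ℕ → P
  twoPoint x y zero = x
  twoPoint x y (suc _) = y

  twoPoint-steps : ∀ {x y} → Step x y → Steps (twoPoint x y)
  twoPoint-steps s zero = s
  twoPoint-steps s (suc _) = refl

  twoPoint-stable : ∀ {x y} → StableFrom model (twoPoint x y) 1
  twoPoint-stable (suc _) _ = refl

  module _ {x y} (s : Step x y) where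
    hop : BPath model
    hop = boundedPath (twoPoint x y) (twoPoint-steps s) 1 twoPoint-stable

    hop-end : path hop (len hop) ≡ y
    hop-end = boundedPath-end (twoPoint x y) (twoPoint-steps s) 1 twoPoint-stable

    hop-before : ∀ {Q : Subset P} → Q x → ∀ i → i < len hop → Q (path hop i)
    hop-before q i i<len
      with ≤-trans i<len (boundedPath-len≤ (twoPoint x y) (twoPoint-steps s) 1 twoPoint-stable)
    ... | s≤s z≤n = q

    hop-after : ∀ {Q : Subset P} → Q y → ∀ i → 0 < i → i ≤ len hop → Q (path hop i)
    hop-after q (suc _) _ _ = q

  ForwardClosed : Subset P → Set
  ForwardClosed Q = ∀ {u v} → E u v → Q u → Q v

  BackwardClosed : Subset P → Set
  BackwardClosed Q = ∀ {u v} → E u v → Q v → Q u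

  path-forward : ∀ {Q} → ForwardClosed Q → (π : BPath model) → Q (path π 0) → ∀ i → Q (path π i)
  path-forward closed π q zero = q
  path-forward {Q} closed π q (suc i) = forward (step π i) (path-forward closed π q i)
    where
    forward : ∀ {u v} → Step u v → Q u → Q v
    forward refl = id
    forward [ e ] = closed e

  path-backward : ∀ {Q} → BackwardClosed Q → (π : BPath model) →
                  ∀ L → Q (path π L) → ∀ i → i ≤ L → Q (path π i)
  path-backward closed π zero q zero _ = q
  path-backward {Q} closed π (suc L) q i i≤sL with m≤n⇒m<n∨m≡n i≤sL
  ... | inj₁ (s≤s i≤L) = path-backward closed π L (backward (step π L) q) i i≤L
    where
    backward : ∀ {u v} → Step u v → Q v → Q u
    backward refl = id
    backward [ e ] = closed e
  ... | inj₂ refl = q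

  module Matching (B : P → P → Set) where
    matchedFrom-seq : ∀ {x₁ x₂ e} π (steps : Steps π) L (stable : StableFrom model π L) →
      π 0 ≡ x₂ → (∀ i → i < L → B x₁ (π i)) → B e (π L) → MatchedFrom model B x₁ x₂ e
    matchedFrom-seq π steps L stable start before end =
      boundedPath π steps L stable , start ,
      (λ i i<len → before i (≤-trans i<len (boundedPath-len≤ π steps L stable))) ,
      subst (B _) (sym (boundedPath-end π steps L stable)) end

    matchedTo-seq : ∀ {x₁ x₂ s} π (steps : Steps π) L (stable : StableFrom model π L) →
      π L ≡ x₂ → (∀ i → 0 < i → i ≤ L → B x₁ (π i)) → B s (π 0) → MatchedTo model B x₁ x₂ s
    matchedTo-seq π steps L stable end after start =
      boundedPath π steps L stable , trans (boundedPath-end π steps L stable) end ,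
      (λ i 0<i i≤len → after i 0<i (≤-trans i≤len (boundedPath-len≤ π steps L stable))) , start

    matchedFrom-stay : ∀ {x₁ x₂ e} → B e x₂ → MatchedFrom model B x₁ x₂ e
    matchedFrom-stay {x₂ = x₂} =
      matchedFrom-seq (λ _ → x₂) (λ _ → refl) 0 (λ _ _ → refl) refl (λ _ ())

    matchedTo-stay : ∀ {x₁ x₂ s} → B s x₂ → MatchedTo model B x₁ x₂ s
    matchedTo-stay {x₂ = x₂} =
      matchedTo-seq (λ _ → x₂) (λ _ → refl) 0 (λ _ _ → refl) refl (λ { _ (s≤s _) () })

    matchedFrom-hop : ∀ {x₁ x₂ y e} (s : Step x₂ y) → B x₁ x₂ → B e y → MatchedFrom model B x₁ x₂ e
    matchedFrom-hop s b₁₂ end =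
      hop s , refl , hop-before s {B _} b₁₂ , subst (B _) (sym (hop-end s)) end

    matchedFrom-hop² : ∀ {x₁ x₂ y z e} → Step x₂ y → Step y z → B x₁ x₂ → B x₁ y → B e z →
                       MatchedFrom model B x₁ x₂ e
    matchedFrom-hop² {x₁} {x₂} {y} {z} x₂↝y y↝z b₁₂ b₁y =
      matchedFrom-seq π steps 2 stable refl before
      where
      π : ℕ → P
      π zero = x₂
      π (suc zero) = y
      π (suc (suc _)) = z
      steps : Steps π
      steps zero = x₂↝y
      steps (suc zero) = y↝z
      steps (suc (suc _)) = refl
      stable : StableFrom model π 2
      stable (suc zero) (s≤s ())
      stable (suc (suc _)) _ = refl
      before : ∀ i → i < 2 → B x₁ (π i)
      before zero _ = b₁₂
      before (suc zero) _ = b₁y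
      before (suc (suc _)) (s≤s (s≤s ()))

    matchedTo-hop : ∀ {x₁ x₂ y s} (st : Step y x₂) → B x₁ x₂ → B s y → MatchedTo model B x₁ x₂ s
    matchedTo-hop st b₁₂ start = hop st , hop-end st , hop-after st {B _} b₁₂ , start

    -- What has to be matched depends on π₁ only through its endpoint, so it suffices to
    -- match the last step of π₁, which starts at a point reachable from x₁ and related to x₂.
    forthFrom-byLastStep : (Reach : P → Subset P) → (∀ x → Reach x x) →
      (∀ x → ForwardClosed (Reach x)) →
      (∀ {x₁ x₂ q e} → B x₁ x₂ → B q x₂ → Reach x₁ q → E q e → MatchedFrom model B x₁ x₂ e) →
      ForthFrom model B
    forthFrom-byLastStep Reach reach-refl reach-closed lastEdge {x₂ = x₂} b π₁ refl before =
      go (len π₁) before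
      where
      lastStep : ∀ {q e} → B q x₂ → Reach (path π₁ 0) q → Step q e →
                 MatchedFrom model B (path π₁ 0) x₂ e
      lastStep bq _ refl = matchedFrom-stay bq
      lastStep bq reach [ q→e ] = lastEdge b bq reach q→e
      go : ∀ ℓ → (∀ i → i < ℓ → B (path π₁ i) x₂) → MatchedFrom model B (path π₁ 0) x₂ (path π₁ ℓ)
      go zero _ = matchedFrom-stay b
      go (suc k) before′ =
        lastStep (before′ k ≤-refl) (path-forward (reach-closed _) π₁ (reach-refl _) k) (step π₁ k)

    forthTo-byFirstStep : (CoReach : P → Subset P) → (∀ x → CoReach x x) →
      (∀ x → BackwardClosed (CoReach x)) →
      (∀ {x₁ x₂ q s} → B x₁ x₂ → B q x₂ → CoReach x₁ q → E s q → MatchedTo model B x₁ x₂ s) →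
      ForthTo model B
    forthTo-byFirstStep CoReach coreach-refl coreach-closed firstEdge {x₂ = x₂} b π₁ refl after =
      go (len π₁) refl after
      where
      firstStep : ∀ {q s} → B q x₂ → CoReach (path π₁ (len π₁)) q → Step s q →
                  MatchedTo model B (path π₁ (len π₁)) x₂ s
      firstStep bq _ refl = matchedTo-stay bq
      firstStep bq coreach [ s→q ] = firstEdge b bq coreach s→q
      go : ∀ ℓ → ℓ ≡ len π₁ → (∀ i → 0 < i → i ≤ ℓ → B (path π₁ i) x₂) →
           MatchedTo model B (path π₁ (len π₁)) x₂ (path π₁ 0)
      go zero ℓ≡len _ = matchedTo-stay (subst (λ j → B (path π₁ j) x₂) (sym ℓ≡len) b)
      go (suc k) refl after′ = firstStep (after′ 1 (s≤s z≤n) (s≤s z≤n))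
        (path-backward (coreach-closed _) π₁ (suc k) (coreach-refl _) 1 (s≤s z≤n)) (step π₁ 0)

  sameColour⇒sameLabels : ∀ {x y} → red x ≡ red y →
                          ClosureModel.V⁻¹ model x ≐ ClosureModel.V⁻¹ model y
  sameColour⇒sameLabels eq = (λ _ → subst T eq) , (λ _ → subst T (sym eq))

  Homomorphism : (P → P) → Set
  Homomorphism h = ∀ {u v} → E u v → E (h u) (h v)

  PreservesColour : (P → P) → Set
  PreservesColour h = ∀ x → red (h x) ≡ red x

  module _ {h : P → P} (hom : Homomorphism h) (colour : PreservesColour h) where
    mapSteps : (π : BPath model) → Steps (h ∘ path π)
    mapSteps π n = Refl.map hom (step π n)

    mapStable : (π : BPath model) → StableFrom model (h ∘ path π) (len π)
    mapStable π i len≤i = cong h (proj₁ (isLen π) i len≤i)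

    mapPath : BPath model → BPath model
    mapPath π = boundedPath (h ∘ path π) (mapSteps π) (len π) (mapStable π)

    mapPath-end : ∀ π → path (mapPath π) (len (mapPath π)) ≡ h (path π (len π))
    mapPath-end π = boundedPath-end (h ∘ path π) (mapSteps π) (len π) (mapStable π)

    mapPath-sameTrace : ∀ π → SameTrace model π (mapPath π)
    mapPath-sameTrace π i = sameColour⇒sameLabels (sym (colour _))

    mapPath-coversF : ∀ x → TracesCovered model (BPathsF model x) (BPathsF model (h x))
    mapPath-coversF x π start = mapPath π , cong h start , mapPath-sameTrace π

    mapPath-coversT : ∀ x → TracesCovered model (BPathsT model x) (BPathsT model (h x))
    mapPath-coversT x π end = mapPath π , trans (mapPath-end π) (cong h end) , mapPath-sameTrace π

  traceEquivalent-byHomomorphisms : ∀ {f g x₁ x₂} →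
    Homomorphism f → PreservesColour f → f x₁ ≡ x₂ →
    Homomorphism g → PreservesColour g → g x₂ ≡ x₁ → TraceEquivalent model x₁ x₂
  traceEquivalent-byHomomorphisms {x₁ = x₁} {x₂} homf colourf refl homg colourg gx₂≡x₁ =
    sameTraceSets model (mapPath-coversF homf colourf x₁) coversF₂₁ ,
    sameTraceSets model (mapPath-coversT homf colourf x₁) coversT₂₁
    where
    coversF₂₁ : TracesCovered model (BPathsF model x₂) (BPathsF model x₁)
    coversF₂₁ = subst (λ y → TracesCovered model _ (BPathsF model y)) gx₂≡x₁
                      (mapPath-coversF homg colourg x₂)
    coversT₂₁ : TracesCovered model (BPathsT model x₂) (BPathsT model x₁)
    coversT₂₁ = subst (λ y → TracesCovered model _ (BPathsT model y)) gx₂≡x₁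
                      (mapPath-coversT homg colourg x₂)

module Model₁ where
  pattern a = zero
  pattern b = suc zero
  pattern c = suc (suc zero)
  pattern r = suc (suc (suc zero))

  data Edge : Fin 4 → Fin 4 → Set where
    a→r : Edge a r
    b→c : Edge b c
    c→r : Edge c r

  isRed : Fin 4 → Bool
  isRed r = true
  isRed _ = false

  data _∼_ : Fin 4 → Fin 4 → Set where
    a∼a : a ∼ a
    a∼b : a ∼ b
    a∼c : a ∼ c
    b∼b : b ∼ b
    c∼c : c ∼ c
    r∼r : r ∼ r

  ∼-colour : ∀ {x y} → x ∼ y → isRed x ≡ isRed y
  ∼-colour a∼a = refl
  ∼-colour a∼b = refl
  ∼-colour a∼c = refl
  ∼-colour b∼b = refl
  ∼-colour c∼c = refl
  ∼-colour r∼r = refl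

  Reach : Fin 4 → Fin 4 → Set
  Reach a a = ⊤
  Reach a r = ⊤
  Reach b b = ⊤
  Reach b c = ⊤
  Reach b r = ⊤
  Reach c c = ⊤
  Reach c r = ⊤
  Reach r r = ⊤
  Reach _ _ = ⊥

  reach-refl : ∀ x → Reach x x
  reach-refl a = tt
  reach-refl b = tt
  reach-refl c = tt
  reach-refl r = tt

  reach-forward : ∀ x {u v} → Edge u v → Reach x u → Reach x v
  reach-forward a a→r _ = tt
  reach-forward b b→c _ = tt
  reach-forward b c→r _ = tt
  reach-forward c c→r _ = tt
  reach-forward c a→r ()
  reach-forward r a→r ()
  reach-forward c b→c ()
  reach-forward r b→c ()
  reach-forward r c→r ()

  reach-backward : ∀ x {u v} → Edge u v → Reach v x → Reach u x
  reach-backward r a→r _ = tt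
  reach-backward c b→c _ = tt
  reach-backward r b→c _ = tt
  reach-backward r c→r _ = tt

  notRed-afterB : ∀ {x y} → x ≡ b → ReflClosure Edge x y → T (isRed y) → ⊥
  notRed-afterB refl refl ()
  notRed-afterB refl [ b→c ] ()

  module Graph (AP : Set) = GraphModel {AP} Fin._≟_ a Edge isRed

  module _ {AP : Set} where
    open Graph AP
    open Matching _∼_
    module Converse = Matching (flip _∼_)

    lastEdge : ∀ {x₁ x₂ q e} → x₁ ∼ x₂ → q ∼ x₂ → Reach x₁ q → Edge q e →
               MatchedFrom model _∼_ x₁ x₂ e
    lastEdge a∼a a∼a _ a→r = matchedFrom-hop [ a→r ] a∼a r∼r
    lastEdge a∼b a∼b _ a→r = matchedFrom-hop² [ b→c ] [ c→r ] a∼b a∼c r∼r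
    lastEdge a∼c a∼c _ a→r = matchedFrom-hop [ c→r ] a∼c r∼r
    lastEdge b∼b b∼b _ b→c = matchedFrom-hop [ b→c ] b∼b c∼c
    lastEdge c∼c c∼c _ c→r = matchedFrom-hop [ c→r ] c∼c r∼r

    lastEdge⁻¹ : ∀ {x₁ x₂ q e} → x₂ ∼ x₁ → x₂ ∼ q → Reach x₁ q → Edge q e →
                 MatchedFrom model (flip _∼_) x₁ x₂ e
    lastEdge⁻¹ a∼a a∼a _ a→r = Converse.matchedFrom-hop [ a→r ] a∼a r∼r
    lastEdge⁻¹ a∼b a∼b _ b→c = Converse.matchedFrom-stay a∼c
    lastEdge⁻¹ a∼b a∼c _ c→r = Converse.matchedFrom-hop [ a→r ] a∼b r∼r
    lastEdge⁻¹ a∼c a∼c _ c→r = Converse.matchedFrom-hop [ a→r ] a∼c r∼r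
    lastEdge⁻¹ b∼b b∼b _ b→c = Converse.matchedFrom-hop [ b→c ] b∼b c∼c
    lastEdge⁻¹ c∼c c∼c _ c→r = Converse.matchedFrom-hop [ c→r ] c∼c r∼r

    firstEdge : ∀ {x₁ x₂ q s} → x₁ ∼ x₂ → q ∼ x₂ → Reach q x₁ → Edge s q →
                MatchedTo model _∼_ x₁ x₂ s
    firstEdge c∼c c∼c _ b→c = matchedTo-hop [ b→c ] c∼c b∼b
    firstEdge r∼r r∼r _ a→r = matchedTo-hop [ a→r ] r∼r a∼a
    firstEdge r∼r r∼r _ c→r = matchedTo-hop [ c→r ] r∼r c∼c

    firstEdge⁻¹ : ∀ {x₁ x₂ q s} → x₂ ∼ x₁ → x₂ ∼ q → Reach q x₁ → Edge s q →
                  MatchedTo model (flip _∼_) x₁ x₂ s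
    firstEdge⁻¹ a∼c a∼c _ b→c = Converse.matchedTo-stay a∼b
    firstEdge⁻¹ c∼c c∼c _ b→c = Converse.matchedTo-hop [ b→c ] c∼c b∼b
    firstEdge⁻¹ r∼r r∼r _ a→r = Converse.matchedTo-hop [ a→r ] r∼r a∼a
    firstEdge⁻¹ r∼r r∼r _ c→r = Converse.matchedTo-hop [ c→r ] r∼r c∼c

    bisimilar : CoPaBisimilar model a b
    bisimilar = _∼_ , isBisimulation , a∼b
      where
      isBisimulation : IsCoPaBisimulation model _∼_
      isBisimulation = isCoPaBisimulation model (a , b , a∼b) (sameColour⇒sameLabels ∘ ∼-colour)
        (forthFrom-byLastStep Reach reach-refl reach-forward lastEdge)
        (Converse.forthFrom-byLastStep Reach reach-refl reach-forward lastEdge⁻¹)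
        (forthTo-byFirstStep (flip Reach) reach-refl reach-backward firstEdge)
        (Converse.forthTo-byFirstStep (flip Reach) reach-refl reach-backward firstEdge⁻¹)

    notTraceEquivalent : AP → ¬ TraceEquivalent model a b
    notTraceEquivalent p ((covered , _) , _) =
      let π₂ , start , sameTrace = covered (hop [ a→r ]) refl
      in notRed-afterB start (step π₂ 0) (proj₁ (sameTrace 1) p tt)

module Model₂ where
  pattern x₁ = zero
  pattern r₁ = suc zero
  pattern g₁ = suc (suc zero)
  pattern r₂ = suc (suc (suc zero))
  pattern x₂ = suc (suc (suc (suc zero)))
  pattern r₃ = suc (suc (suc (suc (suc zero))))
  pattern g₃ = suc (suc (suc (suc (suc (suc zero)))))

  data Edge : Fin 7 → Fin 7 → Set where
    x₁→r₁ : Edge x₁ r₁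
    r₁→g₁ : Edge r₁ g₁
    x₁→r₂ : Edge x₁ r₂
    x₂→r₃ : Edge x₂ r₃
    r₃→g₃ : Edge r₃ g₃

  isRed : Fin 7 → Bool
  isRed r₁ = true
  isRed r₂ = true
  isRed r₃ = true
  isRed _ = false

  fold : Fin 7 → Fin 7
  fold x₁ = x₂
  fold r₁ = r₃
  fold g₁ = g₃
  fold r₂ = r₃
  fold y = y

  fold-edge : ∀ {u v} → Edge u v → Edge (fold u) (fold v)
  fold-edge x₁→r₁ = x₂→r₃
  fold-edge r₁→g₁ = r₃→g₃
  fold-edge x₁→r₂ = x₂→r₃
  fold-edge x₂→r₃ = x₂→r₃
  fold-edge r₃→g₃ = r₃→g₃

  fold-colour : ∀ y → isRed (fold y) ≡ isRed y
  fold-colour x₁ = refl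
  fold-colour r₁ = refl
  fold-colour g₁ = refl
  fold-colour r₂ = refl
  fold-colour x₂ = refl
  fold-colour r₃ = refl
  fold-colour g₃ = refl

  embed : Fin 7 → Fin 7
  embed x₂ = x₁
  embed r₃ = r₁
  embed g₃ = g₁
  embed y = y

  embed-edge : ∀ {u v} → Edge u v → Edge (embed u) (embed v)
  embed-edge x₁→r₁ = x₁→r₁
  embed-edge r₁→g₁ = r₁→g₁
  embed-edge x₁→r₂ = x₁→r₂
  embed-edge x₂→r₃ = x₁→r₁
  embed-edge r₃→g₃ = r₁→g₁

  embed-colour : ∀ y → isRed (embed y) ≡ isRed y
  embed-colour x₁ = refl
  embed-colour r₁ = refl
  embed-colour g₁ = refl
  embed-colour r₂ = refl
  embed-colour x₂ = refl
  embed-colour r₃ = refl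
  embed-colour g₃ = refl

  ReachableFromX₂ : Fin 7 → Set
  ReachableFromX₂ x₂ = ⊤
  ReachableFromX₂ r₃ = ⊤
  ReachableFromX₂ g₃ = ⊤
  ReachableFromX₂ _ = ⊥

  reachableFromX₂-forward : ∀ {u v} → Edge u v → ReachableFromX₂ u → ReachableFromX₂ v
  reachableFromX₂-forward x₂→r₃ _ = tt
  reachableFromX₂-forward r₃→g₃ _ = tt

  red-reachableFromX₂ : ∀ y → ReachableFromX₂ y → T (isRed y) → y ≡ r₃
  red-reachableFromX₂ r₃ _ _ = refl

  r₂-sink : ∀ {u v} → Edge u v → u ≡ r₂ → v ≡ r₂
  r₂-sink () refl

  module Graph (AP : Set) = GraphModel {AP} Fin._≟_ x₁ Edge isRed

  module _ {AP : Set} where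
    open Graph AP

    traceEquivalent : TraceEquivalent model x₁ x₂
    traceEquivalent =
      traceEquivalent-byHomomorphisms fold-edge fold-colour refl embed-edge embed-colour refl

    notBisimilar : AP → ¬ CoPaBisimilar model x₁ x₂
    notBisimilar p (B , isBisimulation , x₁Bx₂) = r₂≁r₃ r₂Br₃
      where
      open IsCoPaBisimulation isBisimulation

      red-related : ∀ {x y} → B x y → T (isRed x) → T (isRed y)
      red-related xBy = proj₁ (cond1 xBy) p

      r₂Br₃ : B r₂ r₃
      r₂Br₃ with cond2 x₁Bx₂ (hop [ x₁→r₂ ]) refl (hop-before [ x₁→r₂ ] {λ y → B y x₂} x₁Bx₂)
      ... | π₂ , start , _ , endsRelated = subst (B r₂) end≡r₃ r₂Bend
        where
        r₂Bend : B r₂ (path π₂ (len π₂))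
        r₂Bend = subst (λ y → B y (path π₂ (len π₂))) (hop-end [ x₁→r₂ ]) endsRelated
        end≡r₃ : path π₂ (len π₂) ≡ r₃
        end≡r₃ = red-reachableFromX₂ _
          (path-forward reachableFromX₂-forward π₂ (subst ReachableFromX₂ (sym start) tt) (len π₂))
          (red-related r₂Bend tt)

      r₂≁r₃ : ¬ B r₂ r₃
      r₂≁r₃ r₂Br₃ with cond3 r₂Br₃ (hop [ r₃→g₃ ]) refl (hop-before [ r₃→g₃ ] {B r₂} r₂Br₃)
      ... | π₁ , start , _ , endsRelated = red-related r₂Bg₃ tt
        where
        r₂Bg₃ : B r₂ g₃
        r₂Bg₃ = subst₂ B (path-forward r₂-sink π₁ start (len π₁)) (hop-end [ r₃→g₃ ]) endsRelated

proposition12 : (AP : Set) → AP →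
    (Σ (ClosureModel AP) λ M → ∃ λ x₁ → ∃ λ x₂ →
        CoPaBisimilar M x₁ x₂ × ¬ TraceEquivalent M x₁ x₂)
    × (Σ (ClosureModel AP) λ M → ∃ λ x₁ → ∃ λ x₂ →
        TraceEquivalent M x₁ x₂ × ¬ CoPaBisimilar M x₁ x₂)
proposition12 AP p =
  (Model₁.Graph.model AP , Model₁.a , Model₁.b , Model₁.bisimilar , Model₁.notTraceEquivalent p) ,
  (Model₂.Graph.model AP , Model₂.x₁ , Model₂.x₂ , Model₂.traceEquivalent , Model₂.notBisimilar p)
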